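{- For every graph $H$ and every integer $k\ge 4$, $$\operatorname{gr}_k(P_4:H)=\left\lceil \frac{1+\sqrt{1+8k}}{2}\right\rceil.$$
   Context: All graphs are finite, simple and without isolated vertices (in particular $H$ is non-empty). $P_4$ is the path on four vertices. A $k$-edge-coloring of a graph is a map from its edge set onto $\{1,\dots,k\}$ that is exact, i.e. every one of the $k$ colors is used at least once. An edge-colored graph is rainbow if all its edges have distinct colors and monochromatic if all its edges have the same color. For non-empty graphs $G,H$ and a positive integer $k$, the Gallai-Ramsey number $\operatorname{gr}_k(G:H)$ is the minimum integer $N$ such that for all $n\ge N$, every (exact) $k$-edge-coloring of $K_n$ contains a rainbow subgraph isomorphic to $G$ or a monochromatic subgraph isomorphic to $H$. -}

module Defs where

open import Data.Nat using (ℕ; suc; _+_; _*_; _∸_; _≤_; _<_)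
open import Data.Nat.Combinatorics using (_C_)
open import Data.Fin using (Fin)
open import Data.Empty using (⊥)
open import Data.Bool using (Bool; true)
open import Data.Product using (Σ; ∃; _×_; _,_)
open import Data.Sum using (_⊎_)
open import Relation.Binary.PropositionalEquality using (_≡_; _≢_)
open import Function.Definitions using (Injective)

record Graph : Set where
  field
    vcount     : ℕ
    adj        : Fin vcount → Fin vcount → Bool
    symmetric  : ∀ u v → adj u v ≡ adj v u
    irreflexive : ∀ u → adj u u ≡ true → ⊥
    noIsolated : ∀ u → ∃ λ v → adj u v ≡ true
    nonEmpty   : ∃ λ u → ∃ λ v → adj u v ≡ true
open Graph public

-- An edge-coloring of K_n with colors Fin k: a symmetric function on pairs of
-- distinct vertices (the diagonal values are irrelevant and never used).
record Coloring (n k : ℕ) : Set where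
  field
    col : Fin n → Fin n → Fin k
    col-sym : ∀ u v → u ≢ v → col u v ≡ col v u
open Coloring public

Exact : ∀ {n k} → Coloring n k → Set
Exact {n} {k} c = ∀ (i : Fin k) → ∃ λ u → ∃ λ v → u ≢ v × col c u v ≡ i

RainbowP4 : ∀ {n k} → Coloring n k → Set
RainbowP4 {n} χ =
  Σ (Fin n) λ a → Σ (Fin n) λ b → Σ (Fin n) λ c → Σ (Fin n) λ d →
    (a ≢ b × a ≢ c × a ≢ d × b ≢ c × b ≢ d × c ≢ d) ×
    (col χ a b ≢ col χ b c × col χ a b ≢ col χ c d × col χ b c ≢ col χ c d)

MonoCopy : ∀ {n k} → Coloring n k → Graph → Set
MonoCopy {n} {k} χ H =
  Σ (Fin k) λ i → Σ (Fin (vcount H) → Fin n) λ f →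
    Injective _≡_ _≡_ f ×
    (∀ u v → adj H u v ≡ true → col χ (f u) (f v) ≡ i)

-- Ramsey property at order n: K_n admits an exact
-- k-edge-coloring (i.e. k ≤ n choose 2), and every exact k-edge-coloring of
-- K_n has a rainbow P4 or a monochromatic H.
GRProp : ℕ → Graph → ℕ → Set
GRProp k H n =
  k ≤ n C 2 ×
  (∀ (χ : Coloring n k) → Exact χ → RainbowP4 χ ⊎ MonoCopy χ H)

IsGR-P4 : ℕ → Graph → ℕ → Set
IsGR-P4 k H N =
  (∀ n → N ≤ n → GRProp k H n) ×
  (∀ M → (∀ n → M ≤ n → GRProp k H n) → N ≤ M)

-- N = ⌈(1 + √(1+8k)) / 2⌉, written without reals:
-- N - 1 < (1+√(1+8k))/2 ≤ N  ⟺  N ≥ 1, 1+8k ≤ (2N-1)², and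
-- (2N-3 < 0 or (2N-3)² < 1+8k); with truncated subtraction the last
-- disjunction is exactly (2N ∸ 3)² < 1+8k.
IsCeilFormula : ℕ → ℕ → Set
IsCeilFormula k N =
  1 ≤ N ×
  suc (8 * k) ≤ (2 * N ∸ 1) * (2 * N ∸ 1) ×
  (2 * N ∸ 3) * (2 * N ∸ 3) < suc (8 * k)

{-# OPTIONS --safe #-}
module Submission where

-- Exactness forces a path x–y–z whose two edges differ in colour. With k ≥ 4 some colour
-- is absent from the triangle xyz, and an edge of that colour always completes a rainbow P4,
-- whichever way it meets the triangle. So for k ≥ 4 every exact k-colouring of K_n has a
-- rainbow P4, and gr_k(P4 : H) is simply the least n with k ≤ n(n−1)/2, i.e. the least n
-- for which exact k-colourings of K_n exist. The ceiling formula inverts n ↦ n(n−1)/2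
-- through (2n−1)² = 1 + 8·n(n−1)/2.

open import Defs
open import Data.Nat
  using (ℕ; zero; suc; _+_; _*_; _∸_; _≤_; _<_; _≤′_; ≤′-refl; ≤′-step; z≤n; s≤s; _≤?_)
open import Data.Nat.Properties
  using ( ≤-refl; ≤-trans; <⇒≱; ≰⇒>; m≤n+m; m≤m+n; *-suc; +-cancelʳ-≡; *-monoʳ-≤; *-monoʳ-<
        ; ≤⇒≤′; module ≤-Reasoning)
open import Data.Nat.Combinatorics using (_C_; nC1≡n; nCk+nC[k+1]≡[n+1]C[k+1])
open import Data.Nat.Tactic.RingSolver using (solve-∀)
open import Data.Fin as Fin using (Fin; _≟_)
open import Data.Fin.Properties using (any?; all?; ¬∀⟶∃¬; injective⇒≤)
open import Data.Vec using (_∷_; []; lookup)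
open import Data.Product using (Σ; ∃; _×_; _,_; proj₁; proj₂; map₂)
open import Data.Sum using (inj₁)
open import Function using (_∘_; flip)
open import Function.Definitions using (Injective)
open import Relation.Nullary using (yes; no; contradiction)
open import Relation.Nullary.Decidable using (¬?; decidable-stable)
open import Relation.Binary.PropositionalEquality

missing-colour : ∀ {m k} → m < k → (f : Fin m → Fin k) → ∃ λ ε → ∀ i → f i ≢ ε
missing-colour {m} {k} m<k f with any? (λ ε → all? (λ i → ¬? (f i ≟ ε)))
... | yes found = found
... | no none = contradiction (injective⇒≤ preimage-injective) (<⇒≱ m<k)
  where
    preimage : ∀ ε → ∃ λ i → f i ≡ ε
    preimage ε = map₂ (decidable-stable (f _ ≟ ε))
      (¬∀⟶∃¬ m _ (λ i → ¬? (f i ≟ ε)) (λ avoids → none (ε , avoids)))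

    preimage-injective : Injective _≡_ _≡_ (proj₁ ∘ preimage)
    preimage-injective {ε} {ε′} eq =
      trans (sym (proj₂ (preimage ε))) (trans (cong f eq) (proj₂ (preimage ε′)))

module _ {n k : ℕ} (χ : Coloring n k) where
  open Coloring χ renaming (col to colour; col-sym to colour-sym)

  rainbow-path : ∀ {a b c d} → a ≢ b → a ≢ c → a ≢ d → b ≢ c → b ≢ d → c ≢ d →
    colour a b ≢ colour b c → colour a b ≢ colour c d → colour b c ≢ colour c d → RainbowP4 χ
  rainbow-path ab ac ad bc bd cd ab≢bc ab≢cd bc≢cd =
    _ , _ , _ , _ , (ab , ac , ad , bc , bd , cd) , ab≢bc , ab≢cd , bc≢cd

  TwoColouredPath : Set
  TwoColouredPath = Σ (Fin n) λ x → Σ (Fin n) λ y → Σ (Fin n) λ z →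
    x ≢ y × x ≢ z × y ≢ z × colour x y ≢ colour y z

  two-colours⇒path : ∀ {a b p q} → a ≢ b → p ≢ q → colour a b ≢ colour p q → TwoColouredPath
  two-colours⇒path {a} {b} {p} {q} ab pq ab≢pq with b ≟ p | a ≟ p
  ... | yes refl | _ with a ≟ q
  ...   | yes refl = contradiction (colour-sym a b ab) ab≢pq
  ...   | no aq = a , b , q , ab , aq , pq , ab≢pq
  two-colours⇒path {a} {b} {p} {q} ab pq ab≢pq | no bp | yes refl with b ≟ q
  ...   | yes refl = contradiction refl ab≢pq
  ...   | no bq = b , a , q , ≢-sym ab , bq , pq , ab≢pq ∘ trans (colour-sym a b ab)
  two-colours⇒path {a} {b} {p} {q} ab pq ab≢pq | no bp | no ap with colour a b ≟ colour b p
  ... | no ab≢bp = a , b , p , ab , ap , bp , ab≢bp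
  ... | yes ab≡bp with b ≟ q
  ...   | yes refl = contradiction (trans ab≡bp (colour-sym b p bp)) ab≢pq
  ...   | no bq = b , p , q , bp , bq , pq , ab≢pq ∘ trans ab≡bp

  module _ {x y z : Fin n} (xy : x ≢ y) (xz : x ≢ z) (yz : y ≢ z)
           (xy≢yz : colour x y ≢ colour y z) where

    New : Fin k → Set
    New δ = δ ≢ colour x y × δ ≢ colour y z × δ ≢ colour x z

    New-sym : ∀ {u v} → u ≢ v → New (colour u v) → New (colour v u)
    New-sym {u} {v} uv = subst New (colour-sym u v uv)

    new-into-x⇒rainbow : ∀ {v} → v ≢ x → New (colour v x) → RainbowP4 χ
    new-into-x⇒rainbow {v} vx (≢xy , ≢yz , ≢xz) with v ≟ y | v ≟ z
    ... | yes refl | _ = contradiction (colour-sym y x (≢-sym xy)) ≢xy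
    ... | no _ | yes refl = contradiction (colour-sym z x (≢-sym xz)) ≢xz
    ... | no vy | no vz = rainbow-path vx vy vz xy xz yz ≢xy ≢yz xy≢yz

    new-out-of-z⇒rainbow : ∀ {v} → z ≢ v → New (colour z v) → RainbowP4 χ
    new-out-of-z⇒rainbow {v} zv (≢xy , ≢yz , ≢xz) with v ≟ x | v ≟ y
    ... | yes refl | _ = contradiction (colour-sym z x zv) ≢xz
    ... | no _ | yes refl = contradiction (colour-sym z y zv) ≢yz
    ... | no vx | no vy =
      rainbow-path xy xz (≢-sym vx) yz (≢-sym vy) zv xy≢yz (≢-sym ≢xy) (≢-sym ≢yz)

    new-into-y⇒rainbow : ∀ {v} → v ≢ y → New (colour v y) → RainbowP4 χ
    new-into-y⇒rainbow {v} vy (≢xy , ≢yz , ≢xz) with v ≟ x | v ≟ z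
    ... | yes refl | _ = contradiction refl ≢xy
    ... | no _ | yes refl = contradiction (colour-sym z y (≢-sym yz)) ≢yz
    ... | no vx | no vz with colour x y ≟ colour x z
    ...   | no xy≢xz = rainbow-path vy vx vz (≢-sym xy) yz xz
              (≢xy ∘ flip trans (colour-sym y x (≢-sym xy))) ≢xz
              (xy≢xz ∘ trans (colour-sym x y xy))
    ...   | yes xy≡xz = rainbow-path vy vz vx yz (≢-sym xy) (≢-sym xz)
              ≢yz (≢xz ∘ flip trans (colour-sym z x (≢-sym xz)))
              (λ yz≡zx → xy≢yz (trans xy≡xz (trans (colour-sym x z xz) (sym yz≡zx))))

    -- Unless ux or uz carries the fresh colour (an edge at the triangle, handled above),
    -- one of v–u–x–y, v–u–x–z, v–u–z–y, v–u–z–x is rainbow, since xy and yz differ.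
    new-outside⇒rainbow : ∀ {u v} → u ≢ x → u ≢ y → u ≢ z → v ≢ x → v ≢ y → v ≢ z →
      v ≢ u → New (colour v u) → RainbowP4 χ
    new-outside⇒rainbow {u} {v} ux uy uz vx vy vz vu new@(≢xy , ≢yz , ≢xz)
      with colour u x ≟ colour v u
    ... | yes ux≡vu = new-into-x⇒rainbow ux (subst New (sym ux≡vu) new)
    ... | no ux≢vu with colour u x ≟ colour x y
    ...   | no ux≢xy = rainbow-path vu vx vy ux uy xy (≢-sym ux≢vu) ≢xy ux≢xy
    ...   | yes ux≡xy with colour u x ≟ colour x z
    ...     | no ux≢xz = rainbow-path vu vx vz ux uz xz (≢-sym ux≢vu) ≢xz ux≢xz
    ...     | yes ux≡xz with colour u z ≟ colour v u
    ...       | yes uz≡vu = new-out-of-z⇒rainbow (≢-sym uz)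
                  (subst New (sym (trans (colour-sym z u (≢-sym uz)) uz≡vu)) new)
    ...       | no uz≢vu with colour u z ≟ colour z y
    ...         | no uz≢zy = rainbow-path vu vz vy uz uy (≢-sym yz) (≢-sym uz≢vu)
                    (≢yz ∘ flip trans (colour-sym z y (≢-sym yz))) uz≢zy
    ...         | yes uz≡zy = rainbow-path vu vz vx uz ux (≢-sym xz) (≢-sym uz≢vu)
                    (≢xz ∘ flip trans (colour-sym z x (≢-sym xz))) (xy≢yz ∘ xy≡yz)
      where
        open ≡-Reasoning
        xy≡yz : colour u z ≡ colour z x → colour x y ≡ colour y z
        xy≡yz uz≡zx = begin
          colour x y ≡⟨ sym ux≡xy ⟩
          colour u x ≡⟨ ux≡xz ⟩
          colour x z ≡⟨ colour-sym x z xz ⟩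
          colour z x ≡⟨ sym uz≡zx ⟩
          colour u z ≡⟨ uz≡zy ⟩
          colour z y ≡⟨ colour-sym z y (≢-sym yz) ⟩
          colour y z ∎

    new-colour⇒rainbow : ∀ {u v} → u ≢ v → New (colour u v) → RainbowP4 χ
    new-colour⇒rainbow {u} {v} uv new with u ≟ x | u ≟ y | u ≟ z
    ... | yes refl | _ | _ = new-into-x⇒rainbow (≢-sym uv) (New-sym uv new)
    ... | _ | yes refl | _ = new-into-y⇒rainbow (≢-sym uv) (New-sym uv new)
    ... | _ | _ | yes refl = new-out-of-z⇒rainbow uv new
    ... | no ux | no uy | no uz with v ≟ x | v ≟ y | v ≟ z
    ...   | yes refl | _ | _ = new-into-x⇒rainbow uv new
    ...   | _ | yes refl | _ = new-into-y⇒rainbow uv new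
    ...   | _ | _ | yes refl = new-out-of-z⇒rainbow (≢-sym uv) (New-sym uv new)
    ...   | no vx | no vy | no vz = new-outside⇒rainbow vx vy vz ux uy uz uv new

exact⇒rainbowP4 : ∀ {n k} → 4 ≤ k → (χ : Coloring n k) → Exact χ → RainbowP4 χ
exact⇒rainbowP4 4≤k@(s≤s (s≤s _)) χ exact
  with exact Fin.zero | exact (Fin.suc Fin.zero)
... | a , b , ab , ab≡0 | p , q , pq , pq≡1
  with two-colours⇒path χ ab pq (λ ab≡pq → contradiction (trans (sym ab≡0) (trans ab≡pq pq≡1)) λ ())
... | x , y , z , xy , xz , yz , xy≢yz
  with missing-colour 4≤k (lookup (col χ x y ∷ col χ y z ∷ col χ x z ∷ []))
... | ε , misses with exact ε
... | u , v , uv , uv≡ε = new-colour⇒rainbow χ xy xz yz xy≢yz uv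
  ( misses Fin.zero ∘ avoid , misses (Fin.suc Fin.zero) ∘ avoid ,
    misses (Fin.suc (Fin.suc Fin.zero)) ∘ avoid)
  where
    avoid : ∀ {γ} → col χ u v ≡ γ → γ ≡ ε
    avoid uv≡γ = trans (sym uv≡γ) uv≡ε

C2-suc : ∀ n → suc n C 2 ≡ n + n C 2
C2-suc n = trans (sym (nCk+nC[k+1]≡[n+1]C[k+1] n 1)) (cong (_+ n C 2) (nC1≡n n))

C2-mono : ∀ {m n} → m ≤ n → m C 2 ≤ n C 2
C2-mono = go ∘ ≤⇒≤′
  where
    go : ∀ {m n} → m ≤′ n → m C 2 ≤ n C 2
    go ≤′-refl = ≤-refl
    go {n = suc n} (≤′-step m≤n) =
      ≤-trans (go m≤n) (subst (n C 2 ≤_) (sym (C2-suc n)) (m≤n+m (n C 2) n))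

n≤[1+n]C2 : ∀ n → n ≤ suc n C 2
n≤[1+n]C2 n = subst (n ≤_) (sym (C2-suc n)) (m≤m+n n (n C 2))

C2-double : ∀ n → 2 * (n C 2) + n ≡ n * n
C2-double zero = refl
C2-double (suc n) = begin
  2 * (suc n C 2) + suc n         ≡⟨ cong (λ t → 2 * t + suc n) (C2-suc n) ⟩
  2 * (n + n C 2) + suc n         ≡⟨ regroup n (n C 2) ⟩
  (2 * (n C 2) + n) + (2 * n + 1) ≡⟨ cong (_+ (2 * n + 1)) (C2-double n) ⟩
  n * n + (2 * n + 1)             ≡⟨ square-suc n ⟩
  suc n * suc n                   ∎
  where
    open ≡-Reasoning
    regroup : ∀ n t → 2 * (n + t) + suc n ≡ (2 * t + n) + (2 * n + 1)
    regroup = solve-∀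
    square-suc : ∀ n → n * n + (2 * n + 1) ≡ suc n * suc n
    square-suc = solve-∀

odd-square : ∀ m → suc (2 * m) * suc (2 * m) ≡ suc (8 * (suc m C 2))
odd-square m = +-cancelʳ-≡ (4 * suc m) _ _ (begin
  suc (2 * m) * suc (2 * m) + 4 * suc m ≡⟨ expand m ⟩
  1 + 4 * (suc m * suc m)               ≡⟨ cong (λ s → 1 + 4 * s) (C2-double (suc m)) ⟨
  1 + 4 * (2 * (suc m C 2) + suc m)     ≡⟨ distribute (suc m C 2) (suc m) ⟩
  suc (8 * (suc m C 2)) + 4 * suc m     ∎)
  where
    open ≡-Reasoning
    expand : ∀ m → suc (2 * m) * suc (2 * m) + 4 * suc m ≡ 1 + 4 * (suc m * suc m)
    expand = solve-∀
    distribute : ∀ t s → 1 + 4 * (2 * t + s) ≡ suc (8 * t) + 4 * s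
    distribute = solve-∀

2[1+n]∸1 : ∀ n → 2 * suc n ∸ 1 ≡ suc (2 * n)
2[1+n]∸1 n = cong (_∸ 1) (*-suc 2 n)

C2-threshold⇒ceilFormula : ∀ {k} P → P C 2 < k → k ≤ suc P C 2 → IsCeilFormula k (suc P)
C2-threshold⇒ceilFormula {k} P lower upper = s≤s z≤n , above , below P lower
  where
    open ≤-Reasoning
    above : suc (8 * k) ≤ (2 * suc P ∸ 1) * (2 * suc P ∸ 1)
    above = begin
      suc (8 * k)                       ≤⟨ s≤s (*-monoʳ-≤ 8 upper) ⟩
      suc (8 * (suc P C 2))             ≡⟨ odd-square P ⟨
      suc (2 * P) * suc (2 * P)         ≡⟨ cong (λ w → w * w) (2[1+n]∸1 P) ⟨
      (2 * suc P ∸ 1) * (2 * suc P ∸ 1) ∎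
    below : ∀ P → P C 2 < k → (2 * suc P ∸ 3) * (2 * suc P ∸ 3) < suc (8 * k)
    below zero _ = s≤s z≤n
    below (suc j) lower = begin-strict
      (2 * suc (suc j) ∸ 3) * (2 * suc (suc j) ∸ 3)
        ≡⟨ cong (λ w → w * w) (trans (cong (_∸ 3) (*-suc 2 (suc j))) (2[1+n]∸1 j)) ⟩
      suc (2 * j) * suc (2 * j)  ≡⟨ odd-square j ⟩
      suc (8 * (suc j C 2))      <⟨ s≤s (*-monoʳ-< 8 lower) ⟩
      suc (8 * k)                ∎

discrete-crossing : ∀ (f : ℕ → ℕ) {k} m → f 0 < k → k ≤ f m → ∃ λ P → f P < k × k ≤ f (suc P)
discrete-crossing f zero f0<k k≤f0 = contradiction k≤f0 (<⇒≱ f0<k)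
discrete-crossing f {k} (suc m) f0<k k≤f[1+m] with k ≤? f m
... | yes k≤fm = discrete-crossing f m f0<k k≤fm
... | no k≰fm = m , ≰⇒> k≰fm , k≤f[1+m]

C2-threshold⇒isGR-P4 : ∀ {k} H P → (∀ {n} (χ : Coloring n k) → Exact χ → RainbowP4 χ) →
  P C 2 < k → k ≤ suc P C 2 → IsGR-P4 k H (suc P)
C2-threshold⇒isGR-P4 {k} H P always-rainbow lower upper = holds , least
  where
    holds : ∀ n → suc P ≤ n → GRProp k H n
    holds n 1+P≤n = ≤-trans upper (C2-mono 1+P≤n) , λ χ exact → inj₁ (always-rainbow χ exact)
    least : ∀ M → (∀ n → M ≤ n → GRProp k H n) → suc P ≤ M
    least M gr = ≰⇒> λ M≤P → <⇒≱ lower (≤-trans (proj₁ (gr M ≤-refl)) (C2-mono M≤P))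

corollary3p4 : (H : Graph) (k : ℕ) → 4 ≤ k →
    ∃ λ N → IsCeilFormula k N × IsGR-P4 k H N
corollary3p4 H k 4≤k =
  let P , lower , upper = discrete-crossing (_C 2) (suc k) (≤-trans (s≤s z≤n) 4≤k) (n≤[1+n]C2 k)
  in suc P , C2-threshold⇒ceilFormula P lower upper ,
     C2-threshold⇒isGR-P4 H P (exact⇒rainbowP4 4≤k) lower upper
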